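{- Let $n \geq 1$ and let $d \geq 1$. Consider the square matrix $(C(\nu,\lambda))$ whose rows are indexed by the elements $\nu \in \mathbb{N}^n$ with $|\nu| = d$ and $\nu_1 \geq \nu_2 \geq \cdots \geq \nu_n$ (the representatives of the classes of $\{\nu : |\nu| = d\}/\sim$), ordered so that $\nu$ comes before $\mu$ iff $\nu$ is lexicographically larger than $\mu$ (so $(d,0,\ldots,0)$ comes first), and whose columns are indexed by the $\lambda \in \mathbb{N}^n$ with $\|\lambda\| = d$, where the column $\lambda = \phi(\nu)$ is placed in the same position as the row $\nu$. Then this matrix is lower triangular with all diagonal entries equal to $1$: $C(\nu, \phi(\nu)) = 1$ for every row index $\nu$, and $C(\mu, \phi(\nu)) = 0$ whenever $\mu$ comes before $\nu$.
   Context: For $\nu \in \mathbb{N}^n$: $|\nu| = \sum_i \nu_i$, $\|\nu\| = \sum_i i\,\nu_i$, $x^\nu = \prod_i x_i^{\nu_i}$, $\nu! = \prod_i \nu_i!$ ($0!=1$, $0^0=1$). $\nu \sim \mu$ iff $\nu$ is a coordinate permutation of $\mu$. For $\nu$ with $\nu_1 \geq \cdots \geq \nu_n$, $\phi(\nu) = (\nu_1-\nu_2, \ldots, \nu_{n-1}-\nu_n, \nu_n)$; $\phi$ is a bijection from these representatives of degree $d$ onto $\{\lambda : \|\lambda\| = d\}$. The elementary symmetric polynomials are $\sigma^k(x) = \sum_{i_1<\cdots<i_k} x_{i_1}\cdots x_{i_k}$. Write $\sigma^i(x) = \sum_\mu \frac{\sigma^i_\mu}{\mu!}x^\mu$, $h_\mu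 = (\sigma^1_\mu,\ldots,\sigma^n_\mu)$ and $(h_\mu)^k = \prod_i (\sigma^i_\mu)^{k_i}$. Order $\mathbb{N}^n$ by $\mu \prec \mu'$ iff $|\mu|<|\mu'|$, or $|\mu|=|\mu'|$ and $\mu$ precedes $\mu'$ lexicographically. For nonzero $\nu$ with $N = |\nu|$ and $\lambda \in \mathbb{N}^n$, $p(\nu,\lambda)$ is the set of tuples $(k_1,\ldots,k_N; l_1,\ldots,l_N)$ in $\mathbb{N}^n$ such that for some $1 \le s \le N$: $k_i = l_i = 0$ for $i \le N-s$; $|k_i|>0$ for $i > N-s$; $0 \prec l_{N-s+1} \prec \cdots \prec l_N$; $\sum_i k_i = \lambda$; $\sum_i |k_i| l_i = \nu$. Then $C(\nu,\lambda) = \lambda! \sum_{p(\nu,\lambda)} \prod_{j=1}^N \frac{(h_{l_j})^{k_j}}{k_j!(l_j!)^{|k_j|}}$, which is the coefficient of $g_\lambda$ in the expression of the coefficient $f_\nu$ of $f = g \circ \sigma$ (with $f = \sum f_\nu x^\nu$, $g = \sum g_\lambda y^\lambda$); equivalently, $C(\nu,\lambda)$ is the coefficient of $x^\nu$ in $\prod_{i=1}^n (\sigma^i(x))^{\lambda_i}$. -}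

module Defs where

open import Data.Nat using (ℕ; zero; suc; _+_; _*_; _∸_; _<_; _≤_)
open import Data.Nat.Properties using (_≟_)
open import Data.Fin using (Fin; toℕ)
open import Data.Product using (_×_; _,_)
open import Data.List using (List; []; _∷_; _++_; map; concatMap)
open import Data.Vec using (Vec; []; _∷_; zipWith; replicate; lookup; tabulate; foldr)
import Data.Vec as Vec
import Data.Vec.Properties as VecP
open import Relation.Binary.PropositionalEquality using (_≡_)
open import Relation.Nullary using (yes; no)

∣_∣ : ∀ {n} → Vec ℕ n → ℕ
∣ ν ∣ = Vec.sum ν

NonIncreasing : ∀ {n} → Vec ℕ n → Set
NonIncreasing {n} ν = (i j : Fin n) → toℕ i ≤ toℕ j → lookup ν j ≤ lookup ν i

data _<lex_ : ∀ {n} → Vec ℕ n → Vec ℕ n → Set where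
  here  : ∀ {n x y} {xs ys : Vec ℕ n} → x < y → (x ∷ xs) <lex (y ∷ ys)
  there : ∀ {n x} {xs ys : Vec ℕ n} → xs <lex ys → (x ∷ xs) <lex (x ∷ ys)

φ : ∀ {n} → Vec ℕ n → Vec ℕ n
φ [] = []
φ (x ∷ []) = x ∷ []
φ (x ∷ y ∷ r) = (x ∸ y) ∷ φ (y ∷ r)

-- Polynomials in n variables with ℕ coefficients, as formal sums of terms
-- (coefficient , exponent vector).
Poly : ℕ → Set
Poly n = List (ℕ × Vec ℕ n)

onePoly : ∀ {n} → Poly n
onePoly {n} = (1 , replicate n 0) ∷ []

_⊗_ : ∀ {n} → Poly n → Poly n → Poly n
p ⊗ q = concatMap (λ { (a , u) → map (λ { (b , v) → (a * b , zipWith _+_ u v) }) q }) p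

_^ᵖ_ : ∀ {n} → Poly n → ℕ → Poly n
p ^ᵖ zero = onePoly
p ^ᵖ suc m = p ⊗ (p ^ᵖ m)

-- exponent vectors of the squarefree monomials x_{i_1}⋯x_{i_k}, i_1<⋯<i_k
subsetExps : (n k : ℕ) → List (Vec ℕ n)
subsetExps zero zero = [] ∷ []
subsetExps zero (suc k) = []
subsetExps (suc n) zero = map (0 ∷_) (subsetExps n zero)
subsetExps (suc n) (suc k) = map (0 ∷_) (subsetExps n (suc k)) ++ map (1 ∷_) (subsetExps n k)

σ : (n k : ℕ) → Poly n
σ n k = map (λ v → (1 , v)) (subsetExps n k)

coeff : ∀ {n} → Vec ℕ n → Poly n → ℕ
coeff ν [] = 0
coeff ν ((a , u) ∷ p) with VecP.≡-dec _≟_ u ν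
... | yes _ = a + coeff ν p
... | no _  = coeff ν p

σProd : ∀ {n} → Vec ℕ n → Poly n
σProd {n} λ' = foldr (λ _ → Poly n) _⊗_ onePoly
  (tabulate (λ (i : Fin n) → σ n (suc (toℕ i)) ^ᵖ lookup λ' i))

C : ∀ {n} → Vec ℕ n → Vec ℕ n → ℕ
C ν λ' = coeff ν (σProd λ')

{-# OPTIONS --safe #-}
module Submission where

-- In the lexicographic order on exponents, σ^k(x_1,…,x_n) (k ≤ n) has leading monomial
-- x_1⋯x_k with coefficient 1, and leading monomials and their coefficients multiply.
-- Hence ∏_i (σ^i)^{λ_i} has leading exponent (Σ_{i≥1} λ_i, Σ_{i≥2} λ_i, …, λ_n) with
-- coefficient 1, and for λ = φ(ν) with ν non-increasing these suffix sums telescope to ν.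

open import Defs
open import Data.Nat using (ℕ; zero; suc; _+_; _*_; _∸_; _<_; _≤_; z≤n; s≤s)
open import Data.Nat.Properties
open import Data.Fin using (Fin; toℕ; zero; suc)
open import Data.Fin.Properties using (toℕ<n)
open import Data.Product using (_×_; _,_; proj₁; proj₂)
open import Data.Sum using (_⊎_; inj₁; inj₂)
open import Data.Empty using (⊥-elim)
open import Function using (_∘_)
open import Data.List using (List; []; _∷_; _++_; map)
open import Data.List.Properties using (map-++; map-∘)
open import Data.List.Relation.Unary.All using (All; []; _∷_)
import Data.List.Relation.Unary.All as All
import Data.List.Relation.Unary.All.Properties as AllP
open import Data.Vec using (Vec; []; _∷_; head; zipWith; replicate; lookup; tabulate; foldr)
import Data.Vec as Vec
import Data.Vec.Properties as VecP
open import Data.Vec.Relation.Binary.Pointwise.Inductive using (Pointwise; []; _∷_; tabulate⁺)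
open import Relation.Binary.PropositionalEquality
open import Relation.Nullary using (Dec; yes; no; ¬_)

module _ {n : ℕ} where

  0ᵛ : Vec ℕ n
  0ᵛ = replicate n 0

  infixl 6 _⊕_
  _⊕_ : Vec ℕ n → Vec ℕ n → Vec ℕ n
  _⊕_ = zipWith _+_

  infixr 7 _·ᵛ_
  _·ᵛ_ : ℕ → Vec ℕ n → Vec ℕ n
  zero  ·ᵛ m = 0ᵛ
  suc l ·ᵛ m = m ⊕ l ·ᵛ m

  ⊕-identityˡ : (v : Vec ℕ n) → 0ᵛ ⊕ v ≡ v
  ⊕-identityˡ = VecP.zipWith-identityˡ +-identityˡ

  ·ᵛ-zeroʳ : (l : ℕ) → l ·ᵛ 0ᵛ ≡ 0ᵛ
  ·ᵛ-zeroʳ zero    = refl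
  ·ᵛ-zeroʳ (suc l) = trans (⊕-identityˡ (l ·ᵛ 0ᵛ)) (·ᵛ-zeroʳ l)

·ᵛ-∷-one : ∀ {n} (l : ℕ) (m : Vec ℕ n) → l ·ᵛ (1 ∷ m) ≡ l ∷ l ·ᵛ m
·ᵛ-∷-one zero    m = refl
·ᵛ-∷-one (suc l) m rewrite ·ᵛ-∷-one l m = refl

⊕-cancelˡ : ∀ {n} (u : Vec ℕ n) {v w : Vec ℕ n} → u ⊕ v ≡ u ⊕ w → v ≡ w
⊕-cancelˡ []      {[]}    {[]}    _ = refl
⊕-cancelˡ (x ∷ u) {y ∷ v} {z ∷ w} e =
  cong₂ _∷_ (+-cancelˡ-≡ x y z (VecP.∷-injectiveˡ e)) (⊕-cancelˡ u (VecP.∷-injectiveʳ e))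

_≤lex_ : ∀ {n} → Vec ℕ n → Vec ℕ n → Set
u ≤lex v = u ≡ v ⊎ u <lex v

<lex-irrefl : ∀ {n} {u : Vec ℕ n} → ¬ (u <lex u)
<lex-irrefl (here x<x) = <-irrefl refl x<x
<lex-irrefl (there p)  = <lex-irrefl p

<lex-trans : ∀ {n} {u v w : Vec ℕ n} → u <lex v → v <lex w → u <lex w
<lex-trans (here p)  (here q)  = here (<-trans p q)
<lex-trans (here p)  (there _) = here p
<lex-trans (there _) (here q)  = here q
<lex-trans (there p) (there q) = there (<lex-trans p q)

≤lex-<lex-trans : ∀ {n} {u v w : Vec ℕ n} → u ≤lex v → v <lex w → u <lex w
≤lex-<lex-trans (inj₁ refl) q = q
≤lex-<lex-trans (inj₂ p)    q = <lex-trans p q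

≤lex∧≢⇒<lex : ∀ {n} {u v : Vec ℕ n} → u ≤lex v → u ≢ v → u <lex v
≤lex∧≢⇒<lex (inj₁ u≡v) u≢v = ⊥-elim (u≢v u≡v)
≤lex∧≢⇒<lex (inj₂ u<v) _   = u<v

≤lex-head : ∀ {n x y} {xs ys : Vec ℕ n} → (x ∷ xs) ≤lex (y ∷ ys) → x ≤ y
≤lex-head (inj₁ refl)      = ≤-refl
≤lex-head (inj₂ (here p))  = <⇒≤ p
≤lex-head (inj₂ (there _)) = ≤-refl

∷-monoʳ-≤lex : ∀ {n} x {u v : Vec ℕ n} → u ≤lex v → (x ∷ u) ≤lex (x ∷ v)
∷-monoʳ-≤lex x (inj₁ refl) = inj₁ refl
∷-monoʳ-≤lex x (inj₂ p)    = inj₂ (there p)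

⊕-monoʳ-<lex : ∀ {n} (u : Vec ℕ n) {v w : Vec ℕ n} → v <lex w → (u ⊕ v) <lex (u ⊕ w)
⊕-monoʳ-<lex (x ∷ u) (here p)  = here (+-monoʳ-< x p)
⊕-monoʳ-<lex (x ∷ u) (there p) = there (⊕-monoʳ-<lex u p)

⊕-mono-<lex-≤lex : ∀ {n} {u a v b : Vec ℕ n} → u <lex a → v ≤lex b → (u ⊕ v) <lex (a ⊕ b)
⊕-mono-<lex-≤lex {v = _ ∷ _} {_ ∷ _} (here p)          q                = here (+-mono-<-≤ p (≤lex-head q))
⊕-mono-<lex-≤lex {v = _ ∷ _} {_ ∷ _} (there p)         (inj₁ refl)      = there (⊕-mono-<lex-≤lex p (inj₁ refl))
⊕-mono-<lex-≤lex {v = _ ∷ _} {_ ∷ _} (there {x = x} _) (inj₂ (here q))  = here (+-monoʳ-< x q)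
⊕-mono-<lex-≤lex {v = _ ∷ _} {_ ∷ _} (there p)         (inj₂ (there q)) = there (⊕-mono-<lex-≤lex p (inj₂ q))

⊕-mono-≤lex : ∀ {n} {u a v b : Vec ℕ n} → u ≤lex a → v ≤lex b → (u ⊕ v) ≤lex (a ⊕ b)
⊕-mono-≤lex         (inj₁ refl) (inj₁ refl) = inj₁ refl
⊕-mono-≤lex {u = u} (inj₁ refl) (inj₂ q)    = inj₂ (⊕-monoʳ-<lex u q)
⊕-mono-≤lex         (inj₂ p)    q           = inj₂ (⊕-mono-<lex-≤lex p q)

coeff-here : ∀ {n} (w : Vec ℕ n) a p → coeff w ((a , w) ∷ p) ≡ a + coeff w p
coeff-here w a p with VecP.≡-dec _≟_ w w
... | yes _  = refl
... | no w≢w = ⊥-elim (w≢w refl)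

coeff-skip : ∀ {n} {u w : Vec ℕ n} a p → u ≢ w → coeff w ((a , u) ∷ p) ≡ coeff w p
coeff-skip {u = u} {w} a p u≢w with VecP.≡-dec _≟_ u w
... | yes u≡w = ⊥-elim (u≢w u≡w)
... | no _    = refl

coeff-++ : ∀ {n} (w : Vec ℕ n) (p q : Poly n) → coeff w (p ++ q) ≡ coeff w p + coeff w q
coeff-++ w []            q = refl
coeff-++ w ((a , u) ∷ p) q with VecP.≡-dec _≟_ u w
... | yes _ = trans (cong (a +_) (coeff-++ w p q)) (sym (+-assoc a _ _))
... | no _  = coeff-++ w p q

LexBounded : ∀ {n} → Vec ℕ n → Poly n → Set
LexBounded m p = All (λ t → proj₂ t ≤lex m) p

coeff-above : ∀ {n} {m w : Vec ℕ n} (p : Poly n) → LexBounded m p → m <lex w → coeff w p ≡ 0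
coeff-above []            []          _   = refl
coeff-above ((a , u) ∷ p) (u≤m ∷ bnd) m<w =
  trans (coeff-skip a p (λ u≡w → <lex-irrefl (≤lex-<lex-trans u≤m (subst (_ <lex_) (sym u≡w) m<w))))
        (coeff-above p bnd m<w)

scaleShift : ∀ {n} → ℕ → Vec ℕ n → ℕ × Vec ℕ n → ℕ × Vec ℕ n
scaleShift a u (b , v) = (a * b , u ⊕ v)

coeff-scaleShift : ∀ {n} (a : ℕ) (u w : Vec ℕ n) (q : Poly n) →
  coeff (u ⊕ w) (map (scaleShift a u) q) ≡ a * coeff w q
coeff-scaleShift a u w [] = sym (*-zeroʳ a)
coeff-scaleShift a u w ((b , v) ∷ q) with VecP.≡-dec _≟_ v w
... | yes refl = begin
  coeff (u ⊕ w) ((a * b , u ⊕ w) ∷ map (scaleShift a u) q) ≡⟨ coeff-here (u ⊕ w) (a * b) _ ⟩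
  a * b + coeff (u ⊕ w) (map (scaleShift a u) q)           ≡⟨ cong (a * b +_) (coeff-scaleShift a u w q) ⟩
  a * b + a * coeff w q                                    ≡⟨ *-distribˡ-+ a b _ ⟨
  a * (b + coeff w q)                                      ∎
  where open ≡-Reasoning
... | no v≢w = trans (coeff-skip (a * b) _ (v≢w ∘ ⊕-cancelˡ u)) (coeff-scaleShift a u w q)

lexBounded-scaleShift : ∀ {n} {u m m' : Vec ℕ n} a (q : Poly n) → u ≤lex m → LexBounded m' q →
  LexBounded (m ⊕ m') (map (scaleShift a u) q)
lexBounded-scaleShift a q u≤m bnd = AllP.map⁺ (All.map (⊕-mono-≤lex u≤m) bnd)

lexBounded-⊗ : ∀ {n} {m m' : Vec ℕ n} (p q : Poly n) → LexBounded m p → LexBounded m' q →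
  LexBounded (m ⊕ m') (p ⊗ q)
lexBounded-⊗ []            q []         _  = []
lexBounded-⊗ ((a , u) ∷ p) q (u≤m ∷ bp) bq =
  AllP.++⁺ (lexBounded-scaleShift a q u≤m bq) (lexBounded-⊗ p q bp bq)

-- Only the terms of p with exponent exactly m can reach the exponent m ⊕ m'.
coeff-⊗ : ∀ {n} {m m' : Vec ℕ n} (p q : Poly n) → LexBounded m p → LexBounded m' q →
  coeff (m ⊕ m') (p ⊗ q) ≡ coeff m p * coeff m' q
coeff-⊗              []            q []         _  = refl
coeff-⊗ {m = m} {m'} ((a , u) ∷ p) q (u≤m ∷ bp) bq = begin
  coeff (m ⊕ m') (map (scaleShift a u) q ++ p ⊗ q)
    ≡⟨ coeff-++ (m ⊕ m') (map (scaleShift a u) q) (p ⊗ q) ⟩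
  coeff (m ⊕ m') (map (scaleShift a u) q) + coeff (m ⊕ m') (p ⊗ q)
    ≡⟨ cong (coeff (m ⊕ m') (map (scaleShift a u) q) +_) (coeff-⊗ p q bp bq) ⟩
  coeff (m ⊕ m') (map (scaleShift a u) q) + coeff m p * coeff m' q
    ≡⟨ headTerm ⟩
  coeff m ((a , u) ∷ p) * coeff m' q ∎
  where
  open ≡-Reasoning
  headTerm : coeff (m ⊕ m') (map (scaleShift a u) q) + coeff m p * coeff m' q
           ≡ coeff m ((a , u) ∷ p) * coeff m' q
  headTerm with VecP.≡-dec _≟_ u m
  ... | yes refl = trans (cong (_+ coeff m p * coeff m' q) (coeff-scaleShift a m m' q))
                         (sym (*-distribʳ-+ (coeff m' q) a (coeff m p)))
  ... | no u≢m   = cong (_+ coeff m p * coeff m' q)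
    (coeff-above _ (lexBounded-scaleShift {m = u} a q (inj₁ refl) bq)
                   (⊕-mono-<lex-≤lex (≤lex∧≢⇒<lex u≤m u≢m) (inj₁ refl)))

Monic : ∀ {n} → Vec ℕ n → Poly n → Set
Monic m p = LexBounded m p × coeff m p ≡ 1

monic-one : ∀ {n} → Monic 0ᵛ (onePoly {n})
monic-one {n} = inj₁ refl ∷ [] , coeff-here (0ᵛ {n}) 1 []

monic-⊗ : ∀ {n} {m m' : Vec ℕ n} {p q : Poly n} → Monic m p → Monic m' q → Monic (m ⊕ m') (p ⊗ q)
monic-⊗ {p = p} {q} (bp , cp) (bq , cq) =
  lexBounded-⊗ p q bp bq , trans (coeff-⊗ p q bp bq) (cong₂ _*_ cp cq)

monic-^ : ∀ {n} {m : Vec ℕ n} {p : Poly n} → Monic m p → ∀ k → Monic (k ·ᵛ m) (p ^ᵖ k)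
monic-^ mp zero    = monic-one
monic-^ mp (suc k) = monic-⊗ mp (monic-^ mp k)

monic-product : ∀ {n k} {ms : Vec (Vec ℕ n) k} {ps : Vec (Poly n) k} → Pointwise Monic ms ps →
  Monic (foldr (λ _ → Vec ℕ n) _⊕_ 0ᵛ ms) (foldr (λ _ → Poly n) _⊗_ onePoly ps)
monic-product []         = monic-one
monic-product (mp ∷ mps) = monic-⊗ mp (monic-product mps)

lift : ∀ {n} → ℕ → Poly n → Poly (suc n)
lift e = map (λ { (a , v) → (a , e ∷ v) })

coeff-lift : ∀ {n} e (w : Vec ℕ n) (p : Poly n) → coeff (e ∷ w) (lift e p) ≡ coeff w p
coeff-lift e w []            = refl
coeff-lift e w ((a , v) ∷ p) = byHead (VecP.≡-dec _≟_ v w)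
  where
  byHead : Dec (v ≡ w) → coeff (e ∷ w) (lift e ((a , v) ∷ p)) ≡ coeff w ((a , v) ∷ p)
  byHead (yes refl) = trans (coeff-here (e ∷ w) a (lift e p))
                            (trans (cong (a +_) (coeff-lift e w p)) (sym (coeff-here w a p)))
  byHead (no v≢w)   = trans (coeff-skip {u = e ∷ v} a (lift e p) (v≢w ∘ VecP.∷-injectiveʳ))
                            (trans (coeff-lift e w p) (sym (coeff-skip a p v≢w)))

coeff-lift-≢ : ∀ {n} {e f} (w : Vec ℕ n) (p : Poly n) → f ≢ e → coeff (e ∷ w) (lift f p) ≡ 0
coeff-lift-≢ w []      f≢e = refl
coeff-lift-≢ w (_ ∷ p) f≢e = trans (coeff-skip _ _ (f≢e ∘ VecP.∷-injectiveˡ)) (coeff-lift-≢ w p f≢e)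

lexBounded-lift : ∀ {n} e {m : Vec ℕ n} (p : Poly n) → LexBounded m p → LexBounded (e ∷ m) (lift e p)
lexBounded-lift e p bnd = AllP.map⁺ (All.map (∷-monoʳ-≤lex e) bnd)

lexBounded-lift-< : ∀ {n} {e f} (m : Vec ℕ n) (p : Poly n) → f < e → LexBounded (e ∷ m) (lift f p)
lexBounded-lift-< m p f<e = AllP.map⁺ (All.universal (λ _ → inj₂ (here f<e)) p)

monic-lift : ∀ {n} e {m : Vec ℕ n} {p : Poly n} → Monic m p → Monic (e ∷ m) (lift e p)
monic-lift e {m} {p} (bnd , c) = lexBounded-lift e p bnd , trans (coeff-lift e m p) c

map-monomial-∷ : ∀ {n} e (vs : List (Vec ℕ n)) →
  map (λ v → (1 , v)) (map (e ∷_) vs) ≡ lift e (map (λ v → (1 , v)) vs)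
map-monomial-∷ e vs = trans (sym (map-∘ vs)) (map-∘ vs)

σ-suc-zero : ∀ n → σ (suc n) zero ≡ lift 0 (σ n zero)
σ-suc-zero n = map-monomial-∷ 0 (subsetExps n zero)

σ-suc-suc : ∀ n k → σ (suc n) (suc k) ≡ lift 0 (σ n (suc k)) ++ lift 1 (σ n k)
σ-suc-suc n k = trans (map-++ _ (map (0 ∷_) (subsetExps n (suc k))) (map (1 ∷_) (subsetExps n k)))
  (cong₂ _++_ (map-monomial-∷ 0 (subsetExps n (suc k))) (map-monomial-∷ 1 (subsetExps n k)))

firstOnes : (n k : ℕ) → Vec ℕ n
firstOnes n       zero    = 0ᵛ
firstOnes zero    (suc k) = []
firstOnes (suc n) (suc k) = 1 ∷ firstOnes n k

monic-σ : ∀ n k → k ≤ n → Monic (firstOnes n k) (σ n k)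
monic-σ zero    zero    _       = monic-one
monic-σ (suc n) zero    _       rewrite σ-suc-zero n = monic-lift 0 (monic-σ n zero z≤n)
monic-σ (suc n) (suc k) (s≤s k≤n) with monic-σ n k k≤n
... | bnd , c rewrite σ-suc-suc n k =
  AllP.++⁺ (lexBounded-lift-< (firstOnes n k) (σ n (suc k)) (s≤s z≤n)) (lexBounded-lift 1 (σ n k) bnd) ,
  (begin
    coeff (1 ∷ firstOnes n k) (lift 0 (σ n (suc k)) ++ lift 1 (σ n k))
      ≡⟨ coeff-++ (1 ∷ firstOnes n k) (lift 0 (σ n (suc k))) (lift 1 (σ n k)) ⟩
    coeff (1 ∷ firstOnes n k) (lift 0 (σ n (suc k))) + coeff (1 ∷ firstOnes n k) (lift 1 (σ n k))
      ≡⟨ cong₂ _+_ (coeff-lift-≢ (firstOnes n k) (σ n (suc k)) λ ()) (coeff-lift 1 (firstOnes n k) (σ n k)) ⟩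
    coeff (firstOnes n k) (σ n k)
      ≡⟨ c ⟩
    1 ∎)
  where open ≡-Reasoning

weightedOnes : ∀ {n k} → (Fin k → ℕ) → Vec ℕ k → Vec ℕ n
weightedOnes {n} ix ls = foldr (λ _ → Vec ℕ n) _⊕_ 0ᵛ (tabulate (λ i → lookup ls i ·ᵛ firstOnes n (ix i)))

weightedOnes-suc : ∀ {n k} (ix : Fin k → ℕ) (ls : Vec ℕ k) →
  weightedOnes {suc n} (suc ∘ ix) ls ≡ Vec.sum ls ∷ weightedOnes {n} ix ls
weightedOnes-suc     ix []       = refl
weightedOnes-suc {n} ix (l ∷ ls)
  rewrite ·ᵛ-∷-one l (firstOnes n (ix zero)) | weightedOnes-suc {n} (ix ∘ suc) ls = refl

weightedOnes-toℕ : ∀ {n k} (l : ℕ) (ls : Vec ℕ k) →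
  weightedOnes {n} toℕ (l ∷ ls) ≡ weightedOnes {n} (suc ∘ toℕ) ls
weightedOnes-toℕ {n} l ls rewrite ·ᵛ-zeroʳ {n} l = ⊕-identityˡ _

suffixSums : ∀ {n} → Vec ℕ n → Vec ℕ n
suffixSums []       = []
suffixSums (l ∷ ls) = Vec.sum (l ∷ ls) ∷ suffixSums ls

weightedOnes≡suffixSums : ∀ {n} (ls : Vec ℕ n) → weightedOnes {n} (suc ∘ toℕ) ls ≡ suffixSums ls
weightedOnes≡suffixSums []       = refl
weightedOnes≡suffixSums (l ∷ ls) = begin
  weightedOnes (suc ∘ toℕ) (l ∷ ls)             ≡⟨ weightedOnes-suc toℕ (l ∷ ls) ⟩
  Vec.sum (l ∷ ls) ∷ weightedOnes toℕ (l ∷ ls)   ≡⟨ cong (Vec.sum (l ∷ ls) ∷_) (weightedOnes-toℕ l ls) ⟩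
  Vec.sum (l ∷ ls) ∷ weightedOnes (suc ∘ toℕ) ls ≡⟨ cong (Vec.sum (l ∷ ls) ∷_) (weightedOnes≡suffixSums ls) ⟩
  suffixSums (l ∷ ls)                            ∎
  where open ≡-Reasoning

monic-σProd : ∀ {n} (ls : Vec ℕ n) → Monic (suffixSums ls) (σProd ls)
monic-σProd {n} ls = subst (λ m → Monic m (σProd ls)) (weightedOnes≡suffixSums ls)
  (monic-product (tabulate⁺ λ i → monic-^ (monic-σ n (suc (toℕ i)) (toℕ<n i)) (lookup ls i)))

nonIncreasing-tail : ∀ {n x} {v : Vec ℕ n} → NonIncreasing (x ∷ v) → NonIncreasing v
nonIncreasing-tail ni i j i≤j = ni (suc i) (suc j) (s≤s i≤j)

nonIncreasing-head : ∀ {n x y} {v : Vec ℕ n} → NonIncreasing (x ∷ y ∷ v) → y ≤ x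
nonIncreasing-head ni = ni zero (suc zero) z≤n

head-suffixSums : ∀ {n} (ls : Vec ℕ (suc n)) → head (suffixSums ls) ≡ Vec.sum ls
head-suffixSums (l ∷ ls) = refl

suffixSums-φ : ∀ {n} (ν : Vec ℕ n) → NonIncreasing ν → suffixSums (φ ν) ≡ ν
suffixSums-φ []          _  = refl
suffixSums-φ (x ∷ [])    _  = cong (_∷ []) (+-identityʳ x)
suffixSums-φ (x ∷ y ∷ v) ni =
  let tail≡ = suffixSums-φ (y ∷ v) (nonIncreasing-tail ni) in
  cong₂ _∷_ (begin
    x ∸ y + Vec.sum (φ (y ∷ v))  ≡⟨ cong (x ∸ y +_) (trans (sym (head-suffixSums (φ (y ∷ v)))) (cong head tail≡)) ⟩
    x ∸ y + y                    ≡⟨ m∸n+n≡m (nonIncreasing-head ni) ⟩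
    x                            ∎) tail≡
  where open ≡-Reasoning

monic-σProd-φ : ∀ {n} (ν : Vec ℕ n) → NonIncreasing ν → Monic ν (σProd (φ ν))
monic-σProd-φ ν ν↓ = subst (λ m → Monic m (σProd (φ ν))) (suffixSums-φ ν ν↓) (monic-σProd (φ ν))

mainTheorem4 : (n d : ℕ) → 1 ≤ n → 1 ≤ d →
    (ν : Vec ℕ n) → ∣ ν ∣ ≡ d → NonIncreasing ν →
    (C ν (φ ν) ≡ 1) ×
    ((μ : Vec ℕ n) → ∣ μ ∣ ≡ d → NonIncreasing μ → ν <lex μ → C μ (φ ν) ≡ 0)
mainTheorem4 n d _ _ ν _ ν↓ = proj₂ monic , λ μ _ _ ν<μ → coeff-above (σProd (φ ν)) (proj₁ monic) ν<μ
  where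
  monic : Monic ν (σProd (φ ν))
  monic = monic-σProd-φ ν ν↓
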